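{- Let $G$ be a totally duplicated genome consisting of a single linear chromosome in which every marker has the same sign as its paralog, let $n$ be its number of distinct markers and let $C$ be the number of cycles of its natural graph $\mathcal{NG}(G)$ (both taken after reduction). Then the BI 1-tandem halving distance satisfies $d^t_{BI}(G)\ge \left\lfloor \frac{n-C}{2}\right\rfloor$.
   Context: Genomes: a linear chromosome is $(\circ~x_1\cdots x_m~\circ)$ with $\circ$ the telomeres; markers are signed, paralogous copies are written $x,\bar{x}$ with $\bar{\bar{x}}=x$; a totally duplicated genome contains every marker exactly twice. An adjacency is a pair of consecutive entries, $(x~y)$ identified with $(-y~-x)$; a double-adjacency is an adjacency $(a~b)$ such that $(\bar{a}~\bar{b})$ is also an adjacency. Reduction: every maximal segment all of whose internal adjacencies are double-adjacencies is rewritten, together with its paralogous segment, as a single marker $y$ and its paralog $\bar{y}$. A 1-tandem duplicated genome is a totally duplicated genome which reduces to $(\circ~y~\bar{y}~\circ)$. A block interchange (BI) on a linear chromosome exchanges the positions of two disjoint segments. $d^t_{BI}(G)$ is the minimum number of BI transforming $G$ into a 1-tandem duplicated genome. Each marker copy has a head and a tail; in $(a~b)$, $a$ contributes its head if positive and tail if negative, $b$ its tail if positive and head if negative. The natural graph $\mathcal{NG}(G)$ has the adjacencies of $G$ as vertices and, for each marker $x$, an edge between the vertices containing the heads of $x$ and $\bar{x}$ and an edge between the vertices containing the tails of $x$ and $\bar{x}$; its components are paths and cycles. -}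

module Defs where

open import Data.Nat using (ℕ; zero; suc; _≤_; _≟_)
open import Data.Bool using (Bool; true; false; not; if_then_else_; _∧_)
open import Data.Product using (Σ; ∃; ∃₂; _×_; _,_; proj₁; proj₂)
open import Data.Product.Properties using (≡-dec)
open import Data.Sum using (_⊎_)
open import Data.Fin using (Fin)
open import Data.Unit using (⊤)
open import Data.List using (List; []; _∷_; _++_; map; concatMap; reverse; length; zip; upTo)
open import Data.Nat.ListAction using (sum)
open import Data.List.NonEmpty using (List⁺; toList; head; last)
open import Data.List.Relation.Unary.All using (All)
open import Data.List.Relation.Unary.Unique.Propositional using (Unique)
open import Data.List.Membership.Propositional using (_∈_)
open import Relation.Nullary using (¬_; does)
open import Relation.Binary.PropositionalEquality using (_≡_; _≢_)
open import Relation.Binary.Construct.Closure.Equivalence using (EqClosure)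
open import Function.Bundles using (_⇔_)
import Data.Bool.Properties as BoolP

-- A marker is a label together with a copy flag:
-- (l , false) is the copy x, (l , true) is its paralog x̄.
Marker : Set
Marker = ℕ × Bool

-- A signed marker: sign (true = positive, false = negative) and marker.
SMarker : Set
SMarker = Bool × Marker

marker : SMarker → Marker
marker = proj₂

sign : SMarker → Bool
sign = proj₁

bar : SMarker → SMarker
bar (s , l , c) = (s , l , not c)

neg : SMarker → SMarker
neg (s , m) = (not s , m)

-- A single linear chromosome (∘ x₁ ⋯ xₘ ∘), written as the list x₁ ⋯ xₘ.
Genome : Set
Genome = List SMarker

-- totally duplicated: every marker occurs exactly twice, as x and x̄
-- (the underlying unsigned marker copies are pairwise distinct, and the
-- paralog of every occurring copy occurs)
TotDup : Genome → Set
TotDup G = Unique (map marker G) × (∀ x → x ∈ G → marker (bar x) ∈ map marker G)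

SameSign : Genome → Set
SameSign G = ∀ x y → x ∈ G → y ∈ G → marker y ≡ marker (bar x) → sign y ≡ sign x

Adj : Genome → SMarker → SMarker → Set
Adj G a b = ∃₂ λ xs ys → G ≡ xs ++ a ∷ b ∷ ys

-- an adjacency (a b) of G such that (ā b̄) ≅ (-b̄ -ā) is also an adjacency of G
DoubleAdj : Genome → SMarker → SMarker → Set
DoubleAdj G a b = Adj G a b × (Adj G (bar a) (bar b) ⊎ Adj G (neg (bar b)) (neg (bar a)))

Internal : (SMarker → SMarker → Set) → List SMarker → Set
Internal P []           = ⊤
Internal P (x ∷ [])     = ⊤
Internal P (x ∷ y ∷ xs) = P x y × Internal P (y ∷ xs)

-- consecutive blocks are separated by adjacencies that are not double
-- (maximality of the segments)
Cuts : Genome → List (List⁺ SMarker × SMarker) → Set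
Cuts G []            = ⊤
Cuts G (p ∷ [])      = ⊤
Cuts G (p ∷ q ∷ ps)  = (¬ DoubleAdj G (last (proj₁ p)) (head (proj₁ q))) × Cuts G (q ∷ ps)

barSeg : List SMarker → List SMarker
barSeg = map bar

revBarSeg : List SMarker → List SMarker
revBarSeg B = reverse (map (λ x → neg (bar x)) B)

-- A reduction of G: G is cut into its maximal segments whose internal
-- adjacencies are all double-adjacencies; each segment is paired with the
-- new signed marker replacing it.
record Reduction (G : Genome) (P : List (List⁺ SMarker × SMarker)) : Set where
  field
    covers   : concatMap (λ p → toList (proj₁ p)) P ≡ G
    internal : All (λ p → Internal (DoubleAdj G) (toList (proj₁ p))) P
    maximal  : Cuts G P
    totdup   : TotDup (map proj₂ P)
    paralog  : ∀ p q → p ∈ P → q ∈ P →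
                 ((proj₂ q ≡ bar (proj₂ p)) ⇔ (toList (proj₁ q) ≡ barSeg (toList (proj₁ p))))
               × ((proj₂ q ≡ neg (bar (proj₂ p))) ⇔ (toList (proj₁ q) ≡ revBarSeg (toList (proj₁ p))))

Reduces : Genome → Genome → Set
Reduces G R = Σ (List (List⁺ SMarker × SMarker)) λ P → Reduction G P × map proj₂ P ≡ R

-- number of distinct markers (a marker and its paralog count once)
nMarkers : Genome → ℕ
nMarkers R = Data.Nat._/_ (length R) 2
  where import Data.Nat

-- Vertices: the adjacencies of R = x₀ ⋯ x_{m-1}, numbered 0 … m:
-- vertex j is (x_{j-1} x_j), vertex 0 = (∘ x₀), vertex m = (x_{m-1} ∘).
-- The entry at (0-based) position i lies between vertices i and i+1.

headV : ℕ → SMarker → ℕ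
headV i x = if sign x then suc i else i

tailV : ℕ → SMarker → ℕ
tailV i x = if sign x then i else suc i

markerEq : Marker → Marker → Bool
markerEq m m' = does (≡-dec _≟_ BoolP._≟_ m m')

indexed : Genome → List (ℕ × SMarker)
indexed R = zip (upTo (length R)) R

-- for every marker x (the copy with flag false) and its paralog x̄:
-- an edge between the vertices containing the heads and one between
-- the vertices containing the tails
edgesFor : (ℕ × SMarker) → (ℕ × SMarker) → List (ℕ × ℕ)
edgesFor (i , x) (j , y) =
  if not (proj₂ (marker x)) ∧ markerEq (marker y) (marker (bar x))
  then (headV i x , headV j y) ∷ (tailV i x , tailV j y) ∷ []
  else []

NGedges : Genome → List (ℕ × ℕ)
NGedges R = concatMap (λ p → concatMap (λ q → edgesFor p q) (indexed R)) (indexed R)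

NGEdge : Genome → ℕ → ℕ → Set
NGEdge R u v = (u , v) ∈ NGedges R

Conn : Genome → ℕ → ℕ → Set
Conn R = EqClosure (NGEdge R)

-- degree (a loop counts twice)
degree : Genome → ℕ → ℕ
degree R v = sum (map (λ e → ind (proj₁ e) + ind (proj₂ e)) (NGedges R))
  where
    open Data.Nat using (_+_)
    ind : ℕ → ℕ
    ind u = if does (u ≟ v) then 1 else 0

IsCycleComp : Genome → ℕ → Set
IsCycleComp R v = ∀ u → Conn R v u → degree R u ≡ 2

NumCycles : Genome → ℕ → Set
NumCycles R k = Σ (Fin k → ℕ) λ f →
    (∀ i → f i ≤ length R × IsCycleComp R (f i))
  × (∀ i j → Conn R (f i) (f j) → i ≡ j)
  × (∀ v → v ≤ length R → IsCycleComp R v → ∃ λ i → Conn R v (f i))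

data BI : Genome → Genome → Set where
  bi : ∀ A X B Y D → X ≢ [] → Y ≢ [] →
       BI (A ++ X ++ B ++ Y ++ D) (A ++ Y ++ B ++ X ++ D)

data BISteps : ℕ → Genome → Genome → Set where
  done : ∀ {G} → BISteps zero G G
  step : ∀ {k G H K} → BI G H → BISteps k H K → BISteps (suc k) G K

OneTandem : Genome → Set
OneTandem H = TotDup H × ∃ λ y → Reduces H (y ∷ bar y ∷ [])

-- Colour the marker extremities so that the two extremities meeting at an adjacency agree, both
-- telomeres get one colour t, and a marker and its paralog carry the same colours. The 1-tandem genome
-- S S̄ with |S| = ℓ has such a colouring with ℓ distinct colours, and a block interchange is undone on
-- colourings by merging the colours at its cut points in two pairs, so G has one with at least ℓ - 2k
-- colours. On the other hand every colour of G is either inside a block of the reduction (and paralogous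
-- blocks carry the same inner colours, so there are at most b = (|G| - |R|) / 2 of these), or t, or the
-- colour of a vertex of NG(R). Colours are constant on the components of NG(R), and a component with a
-- colour other than t avoids both telomere vertices, so all its vertices have degree 2: it is a cycle.
-- Hence ℓ - 2k ≤ 1 + C + b with 2b + |R| = |G| = 2ℓ, which rearranges to the bound.

module Submission where

open import Defs
import Data.Bool as Bool
open import Data.Bool using (Bool; true; false; not; if_then_else_; _∧_; _xor_)
open import Data.Bool.Properties using (not-involutive; ¬-not)
open import Data.Empty using (⊥-elim)
open import Data.List using (List; []; _∷_; _++_; [_]; map; allFin; concatMap; reverse; length; zip; applyUpTo; upTo; filter)
open import Data.List.Properties
  using ( length-++; length-++-sucʳ; length-map; length-upTo; length-tabulate; map-++; map-∘; map-cong; map-cong-local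
        ; ∷-injectiveʳ; reverse-++; reverse-map; unfold-reverse; ++-identityʳ)
open import Data.List.Membership.Propositional using (_∈_; _∉_; find)
open import Data.List.Membership.Propositional.Properties
  using ( ∈-allFin; ∈-∃++; ∈-++⁺ˡ; ∈-++⁺ʳ; ∈-++⁻; ∈-map⁺; ∈-map⁻; ∈-filter⁺; ∈-filter⁻
        ; ∈-concatMap⁺; ∈-concatMap⁻; ∈-upTo⁺)
open import Data.List.Relation.Binary.Permutation.Propositional using (_↭_; ↭-sym; ↭-trans; ↭-reflexive)
open import Data.List.Relation.Binary.Permutation.Propositional.Properties using (∈-resp-↭; ↭-length; ↭-reverse; shifts; ++⁺ˡ)
open import Data.List.Relation.Binary.Subset.Propositional using (_⊆_)
open import Data.List.Relation.Unary.All as All using (All; []; _∷_)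
open import Data.List.Relation.Unary.Any as Any using (here; there)
open import Data.List.Relation.Unary.Unique.Propositional using (Unique; []; _∷_)
open import Data.List.Relation.Unary.Unique.Propositional.Properties using (filter⁺; upTo⁺; map⁺)
open import Data.List.NonEmpty as List⁺ using (List⁺; _∷_; toList)
open import Data.Nat using (ℕ; zero; suc; _≤_; _<_; _∸_; _+_; _*_; _/_; z≤n; s≤s; s≤s⁻¹; _≟_)
open import Data.Nat.DivMod using (m<n*o⇒m/o<n)
open import Data.Nat.ListAction using (sum)
open import Data.Nat.ListAction.Properties using (sum-++)
open import Data.Nat.Properties
open import Algebra.Properties.CommutativeSemigroup +-commutativeSemigroup using () renaming (interchange to +-interchange)
open import Data.Nat.Solver using (module +-*-Solver)
open import Data.Product using (∃; ∃₂; _×_; _,_; proj₁; proj₂)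
open import Data.Product.Properties using (≡-dec)
open import Data.Sum using (_⊎_; inj₁; inj₂)
open import Function using (_∘_)
open import Function.Bundles using (Equivalence)
open import Relation.Binary.Definitions using (DecidableEquality)
open import Relation.Binary.PropositionalEquality using (_≡_; _≢_; refl; sym; trans; cong; cong₂; subst; module ≡-Reasoning)
open import Relation.Binary.Construct.Closure.ReflexiveTransitive using (ε; _◅_)
open import Relation.Binary.Construct.Closure.Symmetric using (fwd; bwd)
open import Relation.Nullary using (Dec; yes; no; does)
open import Relation.Nullary.Decidable using (dec-true; dec-false)

open +-*-Solver using (solve; _:+_; _:*_; _:=_; con)

private variable A B : Set

unique-⊆⇒length≤ : ∀ {xs ys : List A} → Unique xs → xs ⊆ ys → length xs ≤ length ys
unique-⊆⇒length≤ [] _ = z≤n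
unique-⊆⇒length≤ {xs = x ∷ xs} (x∉xs ∷ xs!) xs⊆ys with ∈-∃++ (xs⊆ys (here refl))
... | us , vs , refl = subst (suc (length xs) ≤_) (sym (length-++-sucʳ us x vs)) (s≤s (unique-⊆⇒length≤ xs! xs⊆us++vs))
  where
  xs⊆us++vs : xs ⊆ us ++ vs
  xs⊆us++vs {z} z∈xs with ∈-++⁻ us (xs⊆ys (there z∈xs))
  ... | inj₁ z∈us = ∈-++⁺ˡ z∈us
  ... | inj₂ (here refl) = ⊥-elim (All.lookup x∉xs z∈xs refl)
  ... | inj₂ (there z∈vs) = ∈-++⁺ʳ us z∈vs

nthOr : A → List A → ℕ → A
nthOr a []       _       = a
nthOr a (x ∷ xs) zero    = x
nthOr a (x ∷ xs) (suc j) = nthOr a xs j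

nthOr-beyond : ∀ (a : A) xs {j} → length xs ≤ j → nthOr a (xs ++ [ a ]) j ≡ a
nthOr-beyond a []       {zero}  _         = refl
nthOr-beyond a []       {suc j} _         = refl
nthOr-beyond a (x ∷ xs) {suc j} (s≤s ≤j) = nthOr-beyond a xs ≤j

nthOr-∈ : ∀ (a : A) {z} xs → z ∈ xs → ∃ λ j → j < length xs × nthOr a xs j ≡ z
nthOr-∈ a (x ∷ xs) (here refl) = 0 , s≤s z≤n , refl
nthOr-∈ a (x ∷ xs) (there z∈) with j , j< , ≡z ← nthOr-∈ a xs z∈ = suc j , s≤s j< , ≡z

∈-zip-applyUpTo : ∀ (g : ℕ → ℕ) (xs : List A) {i x} → (i , x) ∈ zip (applyUpTo g (length xs)) xs →
  ∃ λ j → i ≡ g j × ∀ (f : A → ℕ) ys a → nthOr a (map f xs ++ ys) j ≡ f x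
∈-zip-applyUpTo g (x ∷ xs) (here refl) = 0 , refl , λ f ys a → refl
∈-zip-applyUpTo g (x ∷ xs) (there i∈) with j , refl , at ← ∈-zip-applyUpTo (g ∘ suc) xs i∈ = suc j , refl , at

map-proj₁-zip-applyUpTo : ∀ (g : ℕ → ℕ) (xs : List A) → map proj₁ (zip (applyUpTo g (length xs)) xs) ≡ applyUpTo g (length xs)
map-proj₁-zip-applyUpTo g []       = refl
map-proj₁-zip-applyUpTo g (x ∷ xs) = cong (g 0 ∷_) (map-proj₁-zip-applyUpTo (g ∘ suc) xs)

map-proj₂-zip-applyUpTo : ∀ (g : ℕ → ℕ) (xs : List A) → map proj₂ (zip (applyUpTo g (length xs)) xs) ≡ xs
map-proj₂-zip-applyUpTo g []       = refl
map-proj₂-zip-applyUpTo g (x ∷ xs) = cong (x ∷_) (map-proj₂-zip-applyUpTo (g ∘ suc) xs)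

𝟙 : Bool → ℕ
𝟙 b = if b then 1 else 0

∑ : List A → (A → ℕ) → ℕ
∑ xs f = sum (map f xs)

∑-cong : ∀ (xs : List A) {f g : A → ℕ} → (∀ {x} → x ∈ xs → f x ≡ g x) → ∑ xs f ≡ ∑ xs g
∑-cong []       f≡g = refl
∑-cong (x ∷ xs) f≡g = cong₂ _+_ (f≡g (here refl)) (∑-cong xs (f≡g ∘ there))

∑-zero : ∀ (xs : List A) → ∑ xs (λ _ → 0) ≡ 0
∑-zero []       = refl
∑-zero (x ∷ xs) = ∑-zero xs

∑-+ : ∀ (xs : List A) (f g : A → ℕ) → ∑ xs (λ x → f x + g x) ≡ ∑ xs f + ∑ xs g
∑-+ []       f g = refl
∑-+ (x ∷ xs) f g = trans (cong (f x + g x +_) (∑-+ xs f g)) (+-interchange (f x) (g x) (∑ xs f) (∑ xs g))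

∑-*ʳ : ∀ (xs : List A) (f : A → ℕ) a → ∑ xs (λ x → f x * a) ≡ ∑ xs f * a
∑-*ʳ []       f a = refl
∑-*ʳ (x ∷ xs) f a = trans (cong (f x * a +_) (∑-*ʳ xs f a)) (sym (*-distribʳ-+ a (f x) (∑ xs f)))

∑-swap : (xs : List A) (ys : List B) (f : A → B → ℕ) →
         ∑ xs (λ x → ∑ ys (f x)) ≡ ∑ ys (λ y → ∑ xs (λ x → f x y))
∑-swap []       ys f = sym (∑-zero ys)
∑-swap (x ∷ xs) ys f = trans (cong (∑ ys (f x) +_) (∑-swap xs ys f)) (sym (∑-+ ys (f x) _))

∑-concatMap : (g : A → List B) (xs : List A) (f : B → ℕ) →
              ∑ (concatMap g xs) f ≡ ∑ xs (λ x → ∑ (g x) f)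
∑-concatMap g []       f = refl
∑-concatMap g (x ∷ xs) f = begin
  sum (map f (g x ++ concatMap g xs))          ≡⟨ cong sum (map-++ f (g x) _) ⟩
  sum (map f (g x) ++ map f (concatMap g xs))  ≡⟨ sum-++ (map f (g x)) _ ⟩
  ∑ (g x) f + ∑ (concatMap g xs) f             ≡⟨ cong (∑ (g x) f +_) (∑-concatMap g xs f) ⟩
  ∑ (g x) f + ∑ xs (λ x → ∑ (g x) f)           ∎
  where open ≡-Reasoning

∑-map : (g : A → B) (xs : List A) (f : B → ℕ) → ∑ (map g xs) f ≡ ∑ xs (f ∘ g)
∑-map g xs f = cong sum (sym (map-∘ xs))

∑-one : ∀ (xs : List A) → ∑ xs (λ _ → 1) ≡ length xs
∑-one []       = refl
∑-one (x ∷ xs) = cong suc (∑-one xs)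

length-concatMap : (g : A → List B) (xs : List A) → length (concatMap g xs) ≡ ∑ xs (length ∘ g)
length-concatMap g []       = refl
length-concatMap g (x ∷ xs) = trans (length-++ (g x)) (cong (length (g x) +_) (length-concatMap g xs))

module _ (_≟ᴬ_ : DecidableEquality A) where

  ∑-𝟙-∉ : ∀ {v xs} → v ∉ xs → ∑ xs (λ u → 𝟙 (does (u ≟ᴬ v))) ≡ 0
  ∑-𝟙-∉ {v} {[]}     _   = refl
  ∑-𝟙-∉ {v} {x ∷ xs} v∉ =
    cong₂ _+_ (cong 𝟙 (dec-false (x ≟ᴬ v) (λ x≡v → v∉ (here (sym x≡v))))) (∑-𝟙-∉ (v∉ ∘ there))

  ∑-𝟙-unique : ∀ {v xs} → Unique xs → v ∈ xs → ∑ xs (λ u → 𝟙 (does (u ≟ᴬ v))) ≡ 1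
  ∑-𝟙-unique {v} (v∉ ∷ _) (here refl) =
    cong₂ _+_ (cong 𝟙 (dec-true (v ≟ᴬ v) refl)) (∑-𝟙-∉ λ v∈ → All.lookup v∉ v∈ refl)
  ∑-𝟙-unique {v} {x ∷ xs} (x∉ ∷ xs!) (there v∈) =
    cong₂ _+_ (cong 𝟙 (dec-false (x ≟ᴬ v) (All.lookup x∉ v∈))) (∑-𝟙-unique xs! v∈)

barᴹ : Marker → Marker
barᴹ (l , c) = l , not c

markerDec : DecidableEquality Marker
markerDec = ≡-dec _≟_ Bool._≟_

-- m is a copy x and m' its paralog x̄: the condition under which edgesFor draws the edges of x
paired : Marker → Marker → Bool
paired m m' = not (proj₂ m) ∧ markerEq m' (barᴹ m)

markerEq⇒≡ : ∀ m m' → markerEq m m' ≡ true → m ≡ m'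
markerEq⇒≡ m m' eq with markerDec m m'
... | yes m≡m' = m≡m'

paired⇒barᴹ : ∀ m m' → paired m m' ≡ true → m' ≡ barᴹ m
paired⇒barᴹ (l , false) m' eq = markerEq⇒≡ m' (l , true) eq

paired-sym : ∀ m m' → paired m m' ≡ proj₂ m' ∧ markerEq m (barᴹ m')
paired-sym (l , true)  (l' , false) = refl
paired-sym (l , true)  (l' , true)  = sym (dec-false (markerDec (l , true) (l' , false)) λ ())
paired-sym (l , false) (l' , false) = dec-false (markerDec (l' , false) (l , true)) λ ()
paired-sym (l , false) (l' , true) = by-labels (l ≟ l')
  where
  by-labels : Dec (l ≡ l') → markerEq (l' , true) (l , true) ≡ markerEq (l , false) (l' , false)
  by-labels (yes refl) = trans (dec-true (markerDec (l , true) (l , true)) refl)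
                               (sym (dec-true (markerDec (l , false) (l , false)) refl))
  by-labels (no l≢l')  = trans (dec-false (markerDec (l' , true) (l , true)) (l≢l' ∘ sym ∘ cong proj₁))
                               (sym (dec-false (markerDec (l , false) (l' , false)) (l≢l' ∘ cong proj₁)))

𝟙-split : ∀ b w → 𝟙 (not b) * w + 𝟙 b * w ≡ w
𝟙-split true  w = +-identityʳ w
𝟙-split false w = trans (+-identityʳ (w + 0)) (+-identityʳ w)

module Pairing {Z : Set} (key : Z → Marker) (zs : List Z)
  (keys-unique : Unique (map key zs)) (keys-closed : ∀ {z} → z ∈ zs → barᴹ (key z) ∈ map key zs) where

  private
    occurrences : ∀ m → m ∈ map key zs → ∑ zs (λ z → 𝟙 (markerEq (key z) m)) ≡ 1
    occurrences m m∈ = trans (sym (∑-map key zs _)) (∑-𝟙-unique markerDec keys-unique m∈)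

    partners-of-copy : ∀ m → barᴹ m ∈ map key zs → ∑ zs (λ z' → 𝟙 (paired m (key z'))) ≡ 𝟙 (not (proj₂ m))
    partners-of-copy (l , true)  _   = ∑-zero zs
    partners-of-copy (l , false) m∈ = occurrences (l , true) m∈

    partners-of-paralog : ∀ m' → barᴹ m' ∈ map key zs → ∑ zs (λ z → 𝟙 (paired (key z) m')) ≡ 𝟙 (proj₂ m')
    partners-of-paralog m' m∈ = trans (∑-cong zs λ {z} _ → cong 𝟙 (paired-sym (key z) m')) (by-flag m' m∈)
      where
      by-flag : ∀ m' → barᴹ m' ∈ map key zs → ∑ zs (λ z → 𝟙 (proj₂ m' ∧ markerEq (key z) (barᴹ m'))) ≡ 𝟙 (proj₂ m')
      by-flag (l , true)  m∈ = occurrences (l , false) m∈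
      by-flag (l , false) _  = ∑-zero zs

  module _ (w : Z → ℕ) where

    ∑-paired-from : ∑ zs (λ z → ∑ zs (λ z' → 𝟙 (paired (key z) (key z')) * w z)) ≡
                    ∑ zs (λ z → 𝟙 (not (proj₂ (key z))) * w z)
    ∑-paired-from = ∑-cong zs λ {z} z∈ →
      trans (∑-*ʳ zs _ (w z)) (cong (_* w z) (partners-of-copy (key z) (keys-closed z∈)))

    ∑-paired-to : ∑ zs (λ z → ∑ zs (λ z' → 𝟙 (paired (key z) (key z')) * w z')) ≡
                  ∑ zs (λ z' → 𝟙 (proj₂ (key z')) * w z')
    ∑-paired-to = trans (∑-swap zs zs _) (∑-cong zs λ {z'} z'∈ →
      trans (∑-*ʳ zs _ (w z')) (cong (_* w z') (partners-of-paralog (key z') (keys-closed z'∈))))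

    ∑∑-paired : ∑ zs (λ z → ∑ zs (λ z' → 𝟙 (paired (key z) (key z')) * (w z + w z'))) ≡ ∑ zs w
    ∑∑-paired = begin
      ∑ zs (λ z → ∑ zs (λ z' → 𝟙 (paired (key z) (key z')) * (w z + w z')))
        ≡⟨ ∑-cong zs (λ {z} _ → trans (∑-cong zs λ {z'} _ → *-distribˡ-+ (𝟙 (paired (key z) (key z'))) (w z) (w z'))
                                      (∑-+ zs _ _)) ⟩
      ∑ zs (λ z → ∑ zs (λ z' → 𝟙 (paired (key z) (key z')) * w z) + ∑ zs (λ z' → 𝟙 (paired (key z) (key z')) * w z'))
        ≡⟨ ∑-+ zs _ _ ⟩
      ∑ zs (λ z → ∑ zs (λ z' → 𝟙 (paired (key z) (key z')) * w z)) +
      ∑ zs (λ z → ∑ zs (λ z' → 𝟙 (paired (key z) (key z')) * w z'))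
        ≡⟨ cong₂ _+_ ∑-paired-from ∑-paired-to ⟩
      ∑ zs (λ z → 𝟙 (not (proj₂ (key z))) * w z) + ∑ zs (λ z → 𝟙 (proj₂ (key z)) * w z)
        ≡⟨ sym (∑-+ zs _ _) ⟩
      ∑ zs (λ z → 𝟙 (not (proj₂ (key z))) * w z + 𝟙 (proj₂ (key z)) * w z)
        ≡⟨ ∑-cong zs (λ {z} _ → 𝟙-split (proj₂ (key z)) (w z)) ⟩
      ∑ zs w ∎
      where open ≡-Reasoning

    ∑-copies≡∑-paralogs : (∀ {z z'} → z ∈ zs → z' ∈ zs → paired (key z) (key z') ≡ true → w z ≡ w z') →
                          ∑ zs (λ z → 𝟙 (not (proj₂ (key z))) * w z) ≡ ∑ zs (λ z → 𝟙 (proj₂ (key z)) * w z)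
    ∑-copies≡∑-paralogs same = begin
      ∑ zs (λ z → 𝟙 (not (proj₂ (key z))) * w z)                   ≡⟨ sym ∑-paired-from ⟩
      ∑ zs (λ z → ∑ zs (λ z' → 𝟙 (paired (key z) (key z')) * w z))  ≡⟨ ∑-cong zs (λ z∈ → ∑-cong zs (λ z'∈ → shift-weight z∈ z'∈)) ⟩
      ∑ zs (λ z → ∑ zs (λ z' → 𝟙 (paired (key z) (key z')) * w z')) ≡⟨ ∑-paired-to ⟩
      ∑ zs (λ z → 𝟙 (proj₂ (key z)) * w z)                          ∎
      where
      open ≡-Reasoning
      shift-weight : ∀ {z z'} → z ∈ zs → z' ∈ zs → 𝟙 (paired (key z) (key z')) * w z ≡ 𝟙 (paired (key z) (key z')) * w z'
      shift-weight {z} {z'} z∈ z'∈ with paired (key z) (key z') in eq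
      ... | true  = cong (_+ 0) (same z∈ z'∈ eq)
      ... | false = refl

-- Chained colourings

-- χ l e colours extremity e (true: head, false: tail) of both copies of the marker with label l
Colouring : Set
Colouring = ℕ → Bool → ℕ

label : SMarker → ℕ
label x = proj₁ (marker x)

left right : Colouring → SMarker → ℕ
left  χ x = χ (label x) (not (sign x))
right χ x = χ (label x) (sign x)

negBar : SMarker → SMarker
negBar x = neg (bar x)

Chain : Colouring → ℕ → List SMarker → ℕ → Set
Chain χ c []       d = c ≡ d
Chain χ c (x ∷ xs) d = c ≡ left χ x × Chain χ (right χ x) xs d

module _ {χ : Colouring} where

  chain-++⁻ : ∀ xs {c ys d} → Chain χ c (xs ++ ys) d → ∃ λ m → Chain χ c xs m × Chain χ m ys d
  chain-++⁻ []       h       = _ , refl , h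
  chain-++⁻ (x ∷ xs) (c≡ , h) with chain-++⁻ xs h
  ... | m , h₁ , h₂ = m , (c≡ , h₁) , h₂

  chain-++⁺ : ∀ xs {c m ys d} → Chain χ c xs m → Chain χ m ys d → Chain χ c (xs ++ ys) d
  chain-++⁺ []       refl     h₂ = h₂
  chain-++⁺ (x ∷ xs) (c≡ , h₁) h₂ = c≡ , chain-++⁺ xs h₁ h₂

  chain-barSeg : ∀ xs {c d} → Chain χ c xs d → Chain χ c (barSeg xs) d
  chain-barSeg []       h        = h
  chain-barSeg (x ∷ xs) (c≡ , h) = c≡ , chain-barSeg xs h

  left-negBar : ∀ x → left χ (negBar x) ≡ right χ x
  left-negBar (s , l , _) = cong (χ l) (not-involutive s)

  chain-revBarSeg : ∀ xs {c d} → Chain χ c xs d → Chain χ d (revBarSeg xs) c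
  chain-revBarSeg []       c≡d      = sym c≡d
  chain-revBarSeg (x ∷ xs) (c≡ , h) =
    subst (λ ys → Chain χ _ ys _) (sym (unfold-reverse (negBar x) (map negBar xs)))
      (chain-++⁺ (revBarSeg xs) (chain-revBarSeg xs h) (sym (left-negBar x) , sym c≡))

  chain-junctions : ∀ xs {c d} → Chain χ c xs d → c ∷ map (right χ) xs ≡ map (left χ) xs ++ [ d ]
  chain-junctions []       c≡d      = cong [_] c≡d
  chain-junctions (x ∷ xs) (c≡ , h) = cong₂ _∷_ c≡ (chain-junctions xs h)

  extremity-left-or-right : ∀ y e → χ (label y) e ≡ left χ y ⊎ χ (label y) e ≡ right χ y
  extremity-left-or-right (true  , _) true  = inj₂ refl
  extremity-left-or-right (true  , _) false = inj₁ refl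
  extremity-left-or-right (false , _) true  = inj₁ refl
  extremity-left-or-right (false , _) false = inj₂ refl

  chain-colour : ∀ xs {c d y} e → Chain χ c xs d → y ∈ xs → χ (label y) e ∈ map (left χ) xs ++ [ d ]
  chain-colour xs {y = y} e h y∈ with extremity-left-or-right y e
  ... | inj₁ ≡left  rewrite ≡left  = ∈-++⁺ˡ (∈-map⁺ (left χ) y∈)
  ... | inj₂ ≡right rewrite ≡right = subst (right χ y ∈_) (chain-junctions xs h) (there (∈-map⁺ (right χ) y∈))

chain-map : ∀ {χ} (g : ℕ → ℕ) xs {c d} → Chain χ c xs d → Chain (λ l e → g (χ l e)) (g c) xs (g d)
chain-map g []       c≡d      = cong g c≡d
chain-map g (x ∷ xs) (c≡ , h) = cong g c≡ , chain-map g xs h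

chain-cong : ∀ {χ χ'} xs {c d} → (∀ {x} → x ∈ xs → ∀ e → χ (label x) e ≡ χ' (label x) e) →
             Chain χ c xs d → Chain χ' c xs d
chain-cong []       _  h        = h
chain-cong (x ∷ xs) χ≗ (c≡ , h) =
  trans c≡ (χ≗ (here refl) _) , subst (λ c → Chain _ c xs _) (χ≗ (here refl) _) (chain-cong xs (χ≗ ∘ there) h)

chain-resp : ∀ {χ xs c c' d d'} → c ≡ c' → d ≡ d' → Chain χ c xs d → Chain χ c' xs d'
chain-resp refl refl h = h

Realised : Colouring → ℕ → Genome → ℕ → Set
Realised χ t G c = c ≡ t ⊎ ∃₂ λ x e → x ∈ G × χ (label x) e ≡ c

record Colourable (G : Genome) (n : ℕ) : Set where
  field
    colouring : Colouring
    telomere  : ℕ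
    chain     : Chain colouring telomere G telomere
    colours   : List ℕ
    distinct  : Unique colours
    realised  : ∀ {c} → c ∈ colours → Realised colouring telomere G c
    enough    : n ≤ length colours

-- Block interchanges

identify : ℕ → ℕ → ℕ → ℕ
identify u v z = if does (z ≟ u) then v else z

identify-source : ∀ u v → identify u v u ≡ v
identify-source u v rewrite dec-true (u ≟ u) refl = refl

identify-target : ∀ u v → identify u v v ≡ v
identify-target u v with does (v ≟ u)
... | true  = refl
... | false = refl

identify-other : ∀ u v z → z ≢ u → identify u v z ≡ z
identify-other u v z z≢u = cong (λ b → if b then v else z) (dec-false (z ≟ u) z≢u)

identify-moves : ∀ u v z → identify u v z ≢ z → z ≡ u
identify-moves u v z moved with z ≟ u
... | yes z≡u = z≡u
... | no  z≢u = ⊥-elim (moved (identify-other u v z z≢u))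

merge : ℕ → ℕ → ℕ → ℕ → ℕ → ℕ
merge a b c d = identify (identify c a b) (identify c a d) ∘ identify c a

merge-ca : ∀ a b c d → merge a b c d c ≡ merge a b c d a
merge-ca a b c d = cong (identify _ _) (trans (identify-source c a) (sym (identify-target c a)))

merge-bd : ∀ a b c d → merge a b c d b ≡ merge a b c d d
merge-bd a b c d = trans (identify-source (identify c a b) _) (sym (identify-target (identify c a b) _))

merge-moves : ∀ a b c d z → merge a b c d z ≢ z → z ≡ c ⊎ z ≡ identify c a b
merge-moves a b c d z moved with z ≟ c
... | yes z≡c = inj₁ z≡c
... | no  z≢c = inj₂ (identify-moves _ (identify c a d) z (subst (λ w → identify _ _ w ≢ z) (identify-other c a z z≢c) moved))

MovesAtMostTwo : (ℕ → ℕ) → Set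
MovesAtMostTwo g = ∃₂ λ u v → ∀ z → g z ≢ z → z ≡ u ⊎ z ≡ v

length-fixed-points : ∀ g → MovesAtMostTwo g → ∀ {L} → Unique L → length L ∸ 2 ≤ length (filter (λ z → g z ≟ z) L)
length-fixed-points g (u , v , moves) {L} L! = m≤n+o⇒m∸n≤o (length L) 2 (unique-⊆⇒length≤ L! L⊆)
  where
  L⊆ : L ⊆ u ∷ v ∷ filter (λ z → g z ≟ z) L
  L⊆ {z} z∈ with g z ≟ z
  ... | yes fixed = there (there (∈-filter⁺ (λ z → g z ≟ z) z∈ fixed))
  ... | no  moved with moves z moved
  ...   | inj₁ refl = here refl
  ...   | inj₂ refl = there (here refl)

-- with junction colours t a b c d t along A Y B X D, merging c with a and b with d chains A X B Y D
chain-interchange : ∀ A X B Y D {χ t} → Chain χ t (A ++ Y ++ B ++ X ++ D) t →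
  ∃ λ g → MovesAtMostTwo g × Chain (λ l e → g (χ l e)) (g t) (A ++ X ++ B ++ Y ++ D) (g t)
chain-interchange A X B Y D {χ} h
  with a , hA , h₁ ← chain-++⁻ A h
  with b , hY , h₂ ← chain-++⁻ Y h₁
  with c , hB , h₃ ← chain-++⁻ B h₂
  with d , hX , hD ← chain-++⁻ X h₃
  = g , (c , identify c a b , merge-moves a b c d) ,
    chain-++⁺ A (chain-map g A hA)
      (chain-++⁺ X (chain-resp (merge-ca a b c d) refl (chain-map g X hX))
        (chain-++⁺ B (chain-resp (merge-bd a b c d) (merge-ca a b c d) (chain-map g B hB))
          (chain-++⁺ Y (chain-resp refl (merge-bd a b c d) (chain-map g Y hY))
            (chain-map g D hD))))
  where
  g = merge a b c d

interchange-↭ : ∀ (A X B Y D : List SMarker) → A ++ Y ++ B ++ X ++ D ↭ A ++ X ++ B ++ Y ++ D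
interchange-↭ A X B Y D = ++⁺ˡ A (↭-trans (shifts Y B) (↭-trans (++⁺ˡ B (shifts Y X)) (shifts B X)))

colourable-interchange : ∀ A X B Y D {n} → Colourable (A ++ Y ++ B ++ X ++ D) n → Colourable (A ++ X ++ B ++ Y ++ D) (n ∸ 2)
colourable-interchange A X B Y D {n} col with chain-interchange A X B Y D (Colourable.chain col)
... | g , moves , chain' = record
  { colouring = λ l e → g (χ l e)
  ; telomere  = g t
  ; chain     = chain'
  ; colours   = filter (λ z → g z ≟ z) colours
  ; distinct  = filter⁺ (λ z → g z ≟ z) distinct
  ; realised  = realised' ∘ ∈-filter⁻ (λ z → g z ≟ z)
  ; enough    = ≤-trans (∸-monoˡ-≤ 2 enough) (length-fixed-points g moves distinct)
  }
  where
  open Colourable col renaming (colouring to χ; telomere to t)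
  realised' : ∀ {z} → z ∈ colours × g z ≡ z → Realised (λ l e → g (χ l e)) (g t) (A ++ X ++ B ++ Y ++ D) z
  realised' (z∈ , fixed) with realised z∈
  ... | inj₁ refl                    = inj₁ (sym fixed)
  ... | inj₂ (x , e , x∈ , refl) = inj₂ (x , e , ∈-resp-↭ (interchange-↭ A X B Y D) x∈ , fixed)

colourable-BISteps : ∀ {k G H n} → BISteps k G H → Colourable H n → Colourable G (n ∸ (k + k))
colourable-BISteps done col = col
colourable-BISteps {suc k} {n = n} (step (bi A X B Y D _ _) steps) col =
  subst (Colourable _) two-more (colourable-interchange A X B Y D (colourable-BISteps steps col))
  where
  two-more : n ∸ (k + k) ∸ 2 ≡ n ∸ (suc k + suc k)
  two-more = trans (∸-+-assoc n (k + k) 2) (cong (n ∸_) (trans (+-comm (k + k) 2) (sym (cong suc (+-suc k k)))))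

nextColour : (ℕ → ℕ) → ℕ → List SMarker → ℕ
nextColour f t []      = t
nextColour f t (_ ∷ _) = f 1

-- colours the junctions of s₀ ⋯ sₘ₋₁ by f 0, f 1, …, f (m - 1) and the final one by t
closedColouring : (ℕ → ℕ) → ℕ → List SMarker → Colouring
closedColouring f t []      l e = t
closedColouring f t (s ∷ S) l e =
  if does (l ≟ label s) then (if e xor sign s then f 0 else nextColour f t S) else closedColouring (f ∘ suc) t S l e

module _ (f : ℕ → ℕ) (t : ℕ) (s : SMarker) (S : List SMarker) where

  closedColouring-left : left (closedColouring f t (s ∷ S)) s ≡ f 0
  closedColouring-left rewrite dec-true (label s ≟ label s) refl with sign s
  ... | true  = refl
  ... | false = refl

  closedColouring-right : right (closedColouring f t (s ∷ S)) s ≡ nextColour f t S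
  closedColouring-right rewrite dec-true (label s ≟ label s) refl with sign s
  ... | true  = refl
  ... | false = refl

  closedColouring-skip : ∀ {l} e → l ≢ label s → closedColouring f t (s ∷ S) l e ≡ closedColouring (f ∘ suc) t S l e
  closedColouring-skip {l} e l≢s rewrite dec-false (l ≟ label s) l≢s = refl

  closedColouring-agrees : All (label s ≢_) (map label S) →
    ∀ {x} → x ∈ S → ∀ e → closedColouring (f ∘ suc) t S (label x) e ≡ closedColouring f t (s ∷ S) (label x) e
  closedColouring-agrees fresh x∈ e = sym (closedColouring-skip e (λ x≡s → All.lookup fresh (∈-map⁺ label x∈) (sym x≡s)))

closedColouring-chain : ∀ f t s S → Unique (map label (s ∷ S)) → Chain (closedColouring f t (s ∷ S)) (f 0) (s ∷ S) t
closedColouring-chain f t s []       _              = sym (closedColouring-left f t s []) , closedColouring-right f t s []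
closedColouring-chain f t s (s' ∷ S) (fresh ∷ S!) =
  sym (closedColouring-left f t s (s' ∷ S)) ,
  chain-resp {closedColouring f t (s ∷ s' ∷ S)} {s' ∷ S} (sym (closedColouring-right f t s (s' ∷ S))) refl
    (chain-cong {χ' = closedColouring f t (s ∷ s' ∷ S)} (s' ∷ S) (closedColouring-agrees f t s (s' ∷ S) fresh)
      (closedColouring-chain (f ∘ suc) t s' S S!))

closedColouring-lefts : ∀ f t S → Unique (map label S) → map (left (closedColouring f t S)) S ≡ applyUpTo f (length S)
closedColouring-lefts f t []      _              = refl
closedColouring-lefts f t (s ∷ S) (fresh ∷ S!) =
  cong₂ _∷_ (closedColouring-left f t s S)
    (trans (sym (map-cong-local (All.tabulate λ x∈ → closedColouring-agrees f t s S fresh x∈ _)))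
           (closedColouring-lefts (f ∘ suc) t S S!))

labels-unique : ∀ ms {ns} → Unique (ms ++ ns) → (∀ {m} → m ∈ ms → barᴹ m ∈ ns) → Unique (map proj₁ ms)
labels-unique []       _           _      = []
labels-unique (m ∷ ms) (m∉ ∷ ms!) closed = All.tabulate fresh ∷ labels-unique ms ms! (closed ∘ there)
  where
  fresh : ∀ {l} → l ∈ map proj₁ ms → proj₁ m ≢ l
  fresh l∈ refl with ∈-map⁻ proj₁ l∈
  fresh {l} l∈ refl | (l' , c') , m'∈ , l≡ with proj₂ m Bool.≟ c'
  ... | yes refl = All.lookup m∉ (∈-++⁺ˡ m'∈) (cong (_, _) l≡)
  ... | no  c≢c' = All.lookup m∉ (∈-++⁺ʳ ms (subst (_∈ _) m̄'≡m (closed (there m'∈)))) refl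
    where
    m̄'≡m : barᴹ (l' , c') ≡ m
    m̄'≡m = cong₂ _,_ (sym l≡) (sym (¬-not c≢c'))

colourable-closed : ∀ s S {H} → H ≡ (s ∷ S) ++ barSeg (s ∷ S) ++ [] → Unique (map marker H) →
  ∃ λ ℓ → length H ≡ ℓ + ℓ × Colourable H ℓ
colourable-closed s S refl H! = length (s ∷ S) , length-H , record
  { colouring = χ
  ; telomere  = 0
  ; chain     = chain-++⁺ (s ∷ S) S-chain (chain-++⁺ (barSeg (s ∷ S)) (chain-barSeg (s ∷ S) S-chain) refl)
  ; colours   = upTo (length (s ∷ S))
  ; distinct  = upTo⁺ _
  ; realised  = realised
  ; enough    = ≤-reflexive (sym (length-upTo _))
  }
  where
  χ = closedColouring (λ i → i) 0 (s ∷ S)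
  S! : Unique (map label (s ∷ S))
  S! = subst Unique (sym (map-∘ (s ∷ S)))
         (labels-unique (map marker (s ∷ S)) (subst Unique (map-++ marker (s ∷ S) (barSeg (s ∷ S) ++ [])) H!)
           closed)
    where
    closed : ∀ {m} → m ∈ map marker (s ∷ S) → barᴹ m ∈ map marker (barSeg (s ∷ S) ++ [])
    closed m∈ with x , x∈ , refl ← ∈-map⁻ marker {xs = s ∷ S} m∈ = ∈-map⁺ marker (∈-++⁺ˡ (∈-map⁺ bar x∈))
  S-chain : Chain χ 0 (s ∷ S) 0
  S-chain = closedColouring-chain (λ i → i) 0 s S S!
  realised : ∀ {c} → c ∈ upTo (length (s ∷ S)) → Realised χ 0 ((s ∷ S) ++ barSeg (s ∷ S) ++ []) c
  realised {c} c∈ with ∈-map⁻ (left χ) (subst (c ∈_) (sym (closedColouring-lefts (λ i → i) 0 (s ∷ S) S!)) c∈)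
  ... | x , x∈ , refl = inj₂ (x , not (sign x) , ∈-++⁺ˡ x∈ , refl)
  length-H : length ((s ∷ S) ++ barSeg (s ∷ S) ++ []) ≡ length (s ∷ S) + length (s ∷ S)
  length-H = begin
    length ((s ∷ S) ++ barSeg (s ∷ S) ++ [])          ≡⟨ length-++ (s ∷ S) {barSeg (s ∷ S) ++ []} ⟩
    length (s ∷ S) + length (barSeg (s ∷ S) ++ [])    ≡⟨ cong (λ T → length (s ∷ S) + length T) (++-identityʳ (barSeg (s ∷ S))) ⟩
    length (s ∷ S) + length (barSeg (s ∷ S))          ≡⟨ cong (length (s ∷ S) +_) (length-map bar (s ∷ S)) ⟩
    length (s ∷ S) + length (s ∷ S)                   ∎
    where open ≡-Reasoning

colourable-tandem : ∀ {H} → OneTandem H → ∃ λ ℓ → length H ≡ ℓ + ℓ × Colourable H ℓ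
colourable-tandem (H-dup , y , (s ∷ S , _) ∷ (S̄ , _) ∷ [] , red , refl) =
  colourable-closed s S (trans (sym (Reduction.covers red)) (cong (λ T → (s ∷ S) ++ T ++ []) S̄≡)) (proj₁ H-dup)
  where
  S̄≡ : toList S̄ ≡ barSeg (s ∷ S)
  S̄≡ = Equivalence.to (proj₁ (Reduction.paralog red _ _ (here refl) (there (here refl)))) refl

-- The natural graph of a chained genome

module ChainedGenome (R : Genome) (R-dup : TotDup R) {χ : Colouring} {t : ℕ} (chain : Chain χ t R t) where

  -- vertex j of the natural graph is the adjacency just before entry j; its colour is the junction colour there
  vertexColour : ℕ → ℕ
  vertexColour = nthOr t (map (left χ) R ++ [ t ])

  vertexColour-zero : vertexColour 0 ≡ t
  vertexColour-zero = sym (cong (λ J → nthOr t J 0) (chain-junctions R chain))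

  vertexColour-beyond : ∀ {j} → length R ≤ j → vertexColour j ≡ t
  vertexColour-beyond = nthOr-beyond t (map (left χ) R) ∘ subst (_≤ _) (sym (length-map (left χ) R))

  vertexColour-left : ∀ {i x} → (i , x) ∈ indexed R → vertexColour i ≡ left χ x
  vertexColour-left ix∈ with j , refl , at ← ∈-zip-applyUpTo (λ i → i) R ix∈ = at (left χ) [ t ] t

  vertexColour-right : ∀ {i x} → (i , x) ∈ indexed R → vertexColour (suc i) ≡ right χ x
  vertexColour-right {x = x} ix∈ with j , refl , at ← ∈-zip-applyUpTo (λ i → i) R ix∈ = begin
    nthOr t (map (left χ) R ++ [ t ]) (suc j)   ≡⟨ cong (λ J → nthOr t J (suc j)) (chain-junctions R chain) ⟨
    nthOr t (map (right χ) R) j                 ≡⟨ cong (λ J → nthOr t J j) (++-identityʳ (map (right χ) R)) ⟨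
    nthOr t (map (right χ) R ++ []) j           ≡⟨ at (right χ) [] t ⟩
    right χ x                                   ∎
    where open ≡-Reasoning

  vertexColour-head : ∀ {i x} → (i , x) ∈ indexed R → vertexColour (headV i x) ≡ χ (label x) true
  vertexColour-head {x = true  , _} = vertexColour-right
  vertexColour-head {x = false , _} = vertexColour-left

  vertexColour-tail : ∀ {i x} → (i , x) ∈ indexed R → vertexColour (tailV i x) ≡ χ (label x) false
  vertexColour-tail {x = true  , _} = vertexColour-left
  vertexColour-tail {x = false , _} = vertexColour-right

  vertexColour-edgesFor : ∀ {i x j y u v} → (i , x) ∈ indexed R → (j , y) ∈ indexed R →
    (u , v) ∈ edgesFor (i , x) (j , y) → vertexColour u ≡ vertexColour v
  vertexColour-edgesFor {i} {x} {j} {y} ix∈ jy∈ uv∈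
    with not (proj₂ (marker x)) ∧ markerEq (marker y) (marker (bar x)) in xy-paired
  ... | true = edge uv∈
    where
    same-label : label x ≡ label y
    same-label = cong proj₁ (sym (paired⇒barᴹ (marker x) (marker y) xy-paired))
    edge : ∀ {u v} → (u , v) ∈ (headV i x , headV j y) ∷ (tailV i x , tailV j y) ∷ [] → vertexColour u ≡ vertexColour v
    edge (here refl)         =
      trans (vertexColour-head ix∈) (trans (cong (λ l → χ l true) same-label) (sym (vertexColour-head jy∈)))
    edge (there (here refl)) =
      trans (vertexColour-tail ix∈) (trans (cong (λ l → χ l false) same-label) (sym (vertexColour-tail jy∈)))

  vertexColour-edge : ∀ {u v} → NGEdge R u v → vertexColour u ≡ vertexColour v
  vertexColour-edge uv∈
    with a , a∈ , uv∈ ← find (∈-concatMap⁻ _ {xs = indexed R} uv∈)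
    with b , b∈ , uv∈ ← find (∈-concatMap⁻ _ {xs = indexed R} uv∈)
    = vertexColour-edgesFor a∈ b∈ uv∈

  vertexColour-conn : ∀ {u v} → Conn R u v → vertexColour u ≡ vertexColour v
  vertexColour-conn ε              = refl
  vertexColour-conn (fwd uv ◅ conn) = trans (vertexColour-edge uv) (vertexColour-conn conn)
  vertexColour-conn (bwd vu ◅ conn) = trans (sym (vertexColour-edge vu)) (vertexColour-conn conn)

  private
    ind : ℕ → ℕ → ℕ
    ind v u = 𝟙 (does (u ≟ v))

    extremities : ℕ → ℕ × SMarker → ℕ
    extremities v (i , x) = ind v (headV i x) + ind v (tailV i x)

    extremities-at : ∀ v i x → extremities v (i , x) ≡ ind v i + ind v (suc i)
    extremities-at v i (true  , _) = +-comm (ind v (suc i)) (ind v i)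
    extremities-at v i (false , _) = refl

    key : ℕ × SMarker → Marker
    key = marker ∘ proj₂

    keys : map key (indexed R) ≡ map marker R
    keys = trans (map-∘ (indexed R)) (cong (map marker) (map-proj₂-zip-applyUpTo (λ i → i) R))

    open Pairing key (indexed R) (subst Unique (sym keys) (proj₁ R-dup))
      (λ {a} a∈ → subst (_ ∈_) (sym keys)
        (proj₂ R-dup (proj₂ a) (subst (_ ∈_) (map-proj₂-zip-applyUpTo (λ i → i) R) (∈-map⁺ proj₂ a∈))))

    ∑-edgesFor : ∀ v a b → ∑ (edgesFor a b) (λ e → ind v (proj₁ e) + ind v (proj₂ e)) ≡
                 𝟙 (paired (key a) (key b)) * (extremities v a + extremities v b)
    ∑-edgesFor v (i , x) (j , y) with not (proj₂ (marker x)) ∧ markerEq (marker y) (marker (bar x))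
    ... | false = refl
    ... | true  = trans (cong (hx + hy +_) (+-identityʳ (tx + ty))) (trans (+-interchange hx hy tx ty) (sym (+-identityʳ _)))
      where
      hx = ind v (headV i x)
      hy = ind v (headV j y)
      tx = ind v (tailV i x)
      ty = ind v (tailV j y)

  -- an inner vertex holds two extremities, and each extremity lies on exactly one edge (to its paralog)
  degree-inner : ∀ {v} → 0 < v → v < length R → degree R v ≡ 2
  degree-inner {suc v} _ v<m = begin
    degree R v'
      ≡⟨ ∑-concatMap (λ a → concatMap (edgesFor a) I) I _ ⟩
    ∑ I (λ a → ∑ (concatMap (edgesFor a) I) F)
      ≡⟨ ∑-cong I (λ {a} _ → trans (∑-concatMap (edgesFor a) I F) (∑-cong I λ {b} _ → ∑-edgesFor v' a b)) ⟩
    ∑ I (λ a → ∑ I (λ b → 𝟙 (paired (key a) (key b)) * (extremities v' a + extremities v' b)))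
      ≡⟨ ∑∑-paired (extremities v') ⟩
    ∑ I (extremities v')
      ≡⟨ ∑-cong I (λ {a} _ → extremities-at v' (proj₁ a) (proj₂ a)) ⟩
    ∑ I ((λ i → ind v' i + ind v' (suc i)) ∘ proj₁)
      ≡⟨ ∑-map proj₁ I _ ⟨
    ∑ (map proj₁ I) (λ i → ind v' i + ind v' (suc i))
      ≡⟨ cong (λ is → ∑ is (λ i → ind v' i + ind v' (suc i))) (map-proj₁-zip-applyUpTo (λ i → i) R) ⟩
    ∑ (upTo m) (λ i → ind v' i + ind v' (suc i))
      ≡⟨ ∑-+ (upTo m) _ _ ⟩
    ∑ (upTo m) (ind v') + ∑ (upTo m) (ind v' ∘ suc)
      ≡⟨ cong (∑ (upTo m) (ind v') +_) (∑-map suc (upTo m) (ind v')) ⟨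
    ∑ (upTo m) (ind v') + ∑ (map suc (upTo m)) (ind v')
      ≡⟨ cong₂ _+_ (∑-𝟙-unique _≟_ (upTo⁺ m) (∈-upTo⁺ v<m))
                   (∑-𝟙-unique _≟_ (map⁺ suc-injective (upTo⁺ m)) (∈-map⁺ suc (∈-upTo⁺ (≤-trans (n≤1+n _) v<m)))) ⟩
    2 ∎
    where
    open ≡-Reasoning
    v' = suc v
    m  = length R
    I  = indexed R
    F : ℕ × ℕ → ℕ
    F e = ind v' (proj₁ e) + ind v' (proj₂ e)

  cycle-if-not-telomere : ∀ {v} → vertexColour v ≢ t → IsCycleComp R v
  cycle-if-not-telomere {v} ≢t u conn = degree-inner (positive u u-colour) u<m
    where
    u-colour : vertexColour u ≡ vertexColour v
    u-colour = sym (vertexColour-conn conn)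
    positive : ∀ u → vertexColour u ≡ vertexColour v → 0 < u
    positive zero    ≡v = ⊥-elim (≢t (trans (sym ≡v) vertexColour-zero))
    positive (suc _) _  = s≤s z≤n
    u<m : u < length R
    u<m = ≰⇒> λ m≤u → ≢t (trans (sym u-colour) (vertexColour-beyond m≤u))

  realised-colours : ∀ {C} → NumCycles R C →
                     ∃ λ M → length M ≡ C × (∀ {z} → Realised χ t R z → z ∈ t ∷ M)
  realised-colours {C} (rep , _ , _ , covered) =
    map (vertexColour ∘ rep) (allFin C) , trans (length-map _ (allFin C)) (length-tabulate _) , realised∈
    where
    vertices : length (map (left χ) R ++ [ t ]) ≡ suc (length R)
    vertices = trans (length-++ (map (left χ) R)) (trans (+-comm _ 1) (cong suc (length-map (left χ) R)))
    realised∈ : ∀ {z} → Realised χ t R z → z ∈ t ∷ map (vertexColour ∘ rep) (allFin C)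
    realised∈ (inj₁ refl) = here refl
    realised∈ {z} (inj₂ (x , e , x∈ , refl))
      with j , j< , ≡z ← nthOr-∈ t (map (left χ) R ++ [ t ]) (chain-colour R e chain x∈)
      with z ≟ t
    ... | yes z≡t = here z≡t
    ... | no  z≢t
      with i , conn ← covered j (m<1+n⇒m≤n (subst (j <_) vertices j<)) (cycle-if-not-telomere (z≢t ∘ trans (sym ≡z)))
      = there (subst (_∈ _) (trans (sym (vertexColour-conn conn)) ≡z) (∈-map⁺ (vertexColour ∘ rep) (∈-allFin i)))

-- Reduction

Block : Set
Block = List⁺ SMarker × SMarker

body : Block → List SMarker
body p = toList (proj₁ p)

leftEnd : Colouring → List⁺ SMarker → ℕ
leftEnd χ (x ∷ _) = left χ x

lastRight : Colouring → SMarker → List SMarker → ℕ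
lastRight χ x []       = right χ x
lastRight χ x (y ∷ ys) = lastRight χ y ys

rightEnd : Colouring → List⁺ SMarker → ℕ
rightEnd χ (x ∷ xs) = lastRight χ x xs

chain-lastRight : ∀ {χ c d} x xs → Chain χ c (x ∷ xs) d → d ≡ lastRight χ x xs
chain-lastRight x []       (_ , r≡d) = sym r≡d
chain-lastRight x (y ∷ ys) (_ , h)   = chain-lastRight y ys h

chain-ends : ∀ {χ c d} xs → Chain χ c (toList xs) d → c ≡ leftEnd χ xs × d ≡ rightEnd χ xs
chain-ends (x ∷ xs) h = proj₁ h , chain-lastRight x xs h

chain-concatMap⁻ : ∀ {χ c d} (f : Block → List SMarker) P {p} → Chain χ c (concatMap f P) d → p ∈ P →
                   ∃₂ λ c' d' → Chain χ c' (f p) d'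
chain-concatMap⁻ f (p ∷ P) h (here refl) = _ , _ , proj₁ (proj₂ (chain-++⁻ (f p) h))
chain-concatMap⁻ f (p ∷ P) h (there p∈) = chain-concatMap⁻ f P (proj₂ (proj₂ (chain-++⁻ (f p) h))) p∈

innerColours : Colouring → List⁺ SMarker → List ℕ
innerColours χ (_ ∷ xs) = map (left χ) xs

-- colour of extremity e of a marker of sign s placed between the colours a and b
extremityColour : Bool → ℕ → ℕ → Bool → ℕ
extremityColour s a b e = if e xor s then a else b

extremityColour-left : ∀ s a b → extremityColour s a b (not s) ≡ a
extremityColour-left true  a b = refl
extremityColour-left false a b = refl

extremityColour-right : ∀ s a b → extremityColour s a b s ≡ b
extremityColour-right true  a b = refl
extremityColour-right false a b = refl

extremityColour-not : ∀ s a b e → extremityColour (not s) b a e ≡ extremityColour s a b e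
extremityColour-not true  a b true  = refl
extremityColour-not true  a b false = refl
extremityColour-not false a b true  = refl
extremityColour-not false a b false = refl

blockColour : Colouring → Block → Bool → ℕ
blockColour χ (xs , y) = extremityColour (sign y) (leftEnd χ xs) (rightEnd χ xs)

reducedColouring : Colouring → List Block → Colouring
reducedColouring χ []      l e = 0
reducedColouring χ (p ∷ P) l e = if does (l ≟ label (proj₂ p)) then blockColour χ p e else reducedColouring χ P l e

reducedColouring-lookup : ∀ {χ} P {p} → p ∈ P →
  (∀ {q} → q ∈ P → label (proj₂ q) ≡ label (proj₂ p) → ∀ e → blockColour χ q e ≡ blockColour χ p e) →
  ∀ e → reducedColouring χ P (label (proj₂ p)) e ≡ blockColour χ p e
reducedColouring-lookup (q ∷ P) {p} p∈ consistent e with label (proj₂ p) ≟ label (proj₂ q)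
... | yes p≡q rewrite dec-true (label (proj₂ p) ≟ label (proj₂ q)) p≡q = consistent (here refl) (sym p≡q) e
... | no  p≢q rewrite dec-false (label (proj₂ p) ≟ label (proj₂ q)) p≢q with p∈
...   | here refl = ⊥-elim (p≢q refl)
...   | there p∈P = reducedColouring-lookup P p∈P (consistent ∘ there) e

chain-contract : ∀ {χ χ'} P {c d} →
  (∀ {p} → p ∈ P → left χ' (proj₂ p) ≡ leftEnd χ (proj₁ p) × right χ' (proj₂ p) ≡ rightEnd χ (proj₁ p)) →
  Chain χ c (concatMap body P) d → Chain χ' c (map proj₂ P) d
chain-contract []             ends h = h
chain-contract ((xs , y) ∷ P) ends h
  with m , hxs , hP ← chain-++⁻ (toList xs) h
  with c≡ , m≡ ← chain-ends xs hxs
  = trans c≡ (sym (proj₁ (ends (here refl)))) ,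
    chain-resp (trans m≡ (sym (proj₂ (ends (here refl))))) refl (chain-contract P (ends ∘ there) hP)

data Paralogous (p q : Block) : Set where
  same     : proj₂ q ≡ bar (proj₂ p) → body q ≡ barSeg (body p) → Paralogous p q
  reversed : proj₂ q ≡ neg (bar (proj₂ p)) → body q ≡ revBarSeg (body p) → Paralogous p q

barᴹ-involutive : ∀ m → barᴹ (barᴹ m) ≡ m
barᴹ-involutive (l , c) = cong (l ,_) (not-involutive c)

same-label : ∀ x y → label y ≡ label x → marker y ≡ marker x ⊎ marker y ≡ marker (bar x)
same-label x y l≡ with proj₂ (marker y) Bool.≟ proj₂ (marker x)
... | yes c≡ = inj₁ (cong₂ _,_ l≡ c≡)
... | no  c≢ = inj₂ (cong₂ _,_ l≡ (¬-not c≢))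

module Reduced {G : Genome} {P : List Block} (red : Reduction G P) where

  open Reduction red

  paralogous : ∀ {p q} → p ∈ P → q ∈ P → marker (proj₂ q) ≡ marker (bar (proj₂ p)) → Paralogous p q
  paralogous {p} {q} p∈ q∈ m≡ with sign (proj₂ q) Bool.≟ sign (proj₂ p)
  ... | yes s≡ = same y≡ (Equivalence.to (proj₁ (paralog p q p∈ q∈)) y≡)
    where y≡ = cong₂ _,_ s≡ m≡
  ... | no  s≢ = reversed y≡ (Equivalence.to (proj₂ (paralog p q p∈ q∈)) y≡)
    where y≡ = cong₂ _,_ (¬-not s≢) m≡

  paralog-exists : ∀ {p} → p ∈ P → ∃ λ p' → p' ∈ P × marker (proj₂ p') ≡ marker (bar (proj₂ p))
  paralog-exists {p} p∈
    with y , y∈ , m≡ ← ∈-map⁻ marker (proj₂ totdup (proj₂ p) (∈-map⁺ proj₂ p∈))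
    with p' , p'∈ , refl ← ∈-map⁻ proj₂ y∈
    = p' , p'∈ , sym m≡

  paralog-symmetric : ∀ {p q : Block} → marker (proj₂ q) ≡ marker (bar (proj₂ p)) → marker (proj₂ p) ≡ marker (bar (proj₂ q))
  paralog-symmetric {p} m≡ = trans (sym (barᴹ-involutive (marker (proj₂ p)))) (cong barᴹ (sym m≡))

  open Pairing (marker ∘ proj₂) P (subst Unique (sym (map-∘ P)) (proj₁ totdup))
    (λ {p} p∈ → subst (_ ∈_) (sym (map-∘ P)) (proj₂ totdup (proj₂ p) (∈-map⁺ proj₂ p∈)))

  module Chained {χ : Colouring} {t : ℕ} (chain : Chain χ t G t) where

    block-chain : ∀ {p} → p ∈ P → ∃₂ λ c d → Chain χ c (body p) d
    block-chain = chain-concatMap⁻ body P (subst (λ G → Chain χ t G t) (sym covers) chain)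

    paralogous-blockColour : ∀ {p q} → p ∈ P → Paralogous p q → ∀ e → blockColour χ q e ≡ blockColour χ p e
    paralogous-blockColour {xs , y} {xs' , y'} p∈ (same refl xs'≡) e
      with c , d , h ← block-chain p∈
      with c≡ , d≡ ← chain-ends xs h
      with c≡' , d≡' ← chain-ends xs' (subst (λ ys → Chain χ c ys d) (sym xs'≡) (chain-barSeg (toList xs) h))
      = cong₂ (λ a b → extremityColour (sign y) a b e) (trans (sym c≡') c≡) (trans (sym d≡') d≡)
    paralogous-blockColour {xs , y} {xs' , y'} p∈ (reversed refl xs'≡) e
      with c , d , h ← block-chain p∈
      with c≡ , d≡ ← chain-ends xs h
      with d≡' , c≡' ← chain-ends xs' (subst (λ ys → Chain χ d ys c) (sym xs'≡) (chain-revBarSeg (toList xs) h))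
      = trans (cong₂ (λ a b → extremityColour (not (sign y)) a b e) (trans (sym d≡') d≡) (trans (sym c≡') c≡))
              (extremityColour-not (sign y) _ _ e)

    blockColour-consistent : ∀ {p q} → p ∈ P → q ∈ P → label (proj₂ q) ≡ label (proj₂ p) →
                             ∀ e → blockColour χ q e ≡ blockColour χ p e
    blockColour-consistent {p} {q} p∈ q∈ l≡ e with same-label (proj₂ p) (proj₂ q) l≡
    ... | inj₂ m≡ = paralogous-blockColour p∈ (paralogous p∈ q∈ m≡) e
    ... | inj₁ m≡ with p' , p'∈ , m'≡ ← paralog-exists p∈ =
      trans (paralogous-blockColour p'∈ (paralogous p'∈ q∈ (trans m≡ (paralog-symmetric {p} {p'} m'≡))) e)
            (paralogous-blockColour p∈ (paralogous p∈ p'∈ m'≡) e)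

    χᴿ : Colouring
    χᴿ = reducedColouring χ P

    reduced-ends : ∀ {p} → p ∈ P →
                   left χᴿ (proj₂ p) ≡ leftEnd χ (proj₁ p) × right χᴿ (proj₂ p) ≡ rightEnd χ (proj₁ p)
    reduced-ends {xs , y} p∈ =
      trans (reducedColouring-lookup P p∈ (λ q∈ → blockColour-consistent p∈ q∈) _) (extremityColour-left (sign y) _ _) ,
      trans (reducedColouring-lookup P p∈ (λ q∈ → blockColour-consistent p∈ q∈) _) (extremityColour-right (sign y) _ _)

    reduced-chain : Chain χᴿ t (map proj₂ P) t
    reduced-chain = chain-contract P reduced-ends (subst (λ G → Chain χ t G t) (sym covers) chain)

    paralogous-inner : ∀ {p q} → p ∈ P → Paralogous p q → innerColours χ (proj₁ q) ↭ innerColours χ (proj₁ p)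
    paralogous-inner {x ∷ xs , _} {x' ∷ xs' , _} _ (same _ xs'≡) =
      ↭-reflexive (trans (cong (map (left χ)) (∷-injectiveʳ xs'≡)) (sym (map-∘ xs)))
    paralogous-inner {x ∷ xs , _} {x' ∷ xs' , _} p∈ (reversed _ xs'≡) with c , d , h ← block-chain p∈ =
      subst (_↭ map (left χ) xs) (sym (∷-injectiveʳ lefts)) (↭-reverse (map (left χ) xs))
      where
      lefts : map (left χ) (x' ∷ xs') ≡ d ∷ reverse (map (left χ) xs)
      lefts = begin
        map (left χ) (x' ∷ xs')                       ≡⟨ cong (map (left χ)) xs'≡ ⟩
        map (left χ) (reverse (map negBar (x ∷ xs)))  ≡⟨ reverse-map (left χ) (map negBar (x ∷ xs)) ⟩
        reverse (map (left χ) (map negBar (x ∷ xs)))  ≡⟨ cong reverse (map-∘ (x ∷ xs)) ⟨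
        reverse (map (left χ ∘ negBar) (x ∷ xs))      ≡⟨ cong reverse (map-cong left-negBar (x ∷ xs)) ⟩
        reverse (map (right χ) (x ∷ xs))              ≡⟨ cong reverse (∷-injectiveʳ (chain-junctions (x ∷ xs) h)) ⟩
        reverse (map (left χ) xs ++ [ d ])            ≡⟨ reverse-++ (map (left χ) xs) [ d ] ⟩
        d ∷ reverse (map (left χ) xs)                 ∎
        where open ≡-Reasoning

    xInner : Block → List ℕ
    xInner p = if proj₂ (marker (proj₂ p)) then [] else innerColours χ (proj₁ p)

    xInnerColours : List ℕ
    xInnerColours = concatMap xInner P

    ∈-xInnerColours : ∀ {p z} → p ∈ P → proj₂ (marker (proj₂ p)) ≡ false → z ∈ innerColours χ (proj₁ p) → z ∈ xInnerColours
    ∈-xInnerColours {z = z} p∈ copy z∈ =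
      ∈-concatMap⁺ xInner (Any.map (λ { refl → subst (λ b → z ∈ (if b then [] else _)) (sym copy) z∈ }) p∈)

    inner⊆xInnerColours : ∀ {p z} → p ∈ P → z ∈ innerColours χ (proj₁ p) → z ∈ xInnerColours
    inner⊆xInnerColours {p} p∈ z∈ with proj₂ (marker (proj₂ p)) in flag
    ... | false = ∈-xInnerColours p∈ flag z∈
    ... | true with p' , p'∈ , m≡ ← paralog-exists p∈ =
      ∈-xInnerColours p'∈ (trans (cong proj₂ m≡) (cong not flag))
        (∈-resp-↭ (paralogous-inner p'∈ (paralogous p'∈ p∈ (paralog-symmetric {p} {p'} m≡))) z∈)

    junction-colour : ∀ {p c d z} → p ∈ P → Chain χ c (body p) d → z ∈ map (left χ) (body p) ++ [ d ] →
                      Realised χᴿ t (map proj₂ P) z ⊎ z ∈ xInnerColours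
    junction-colour {x ∷ xs , y} p∈ h (here refl) =
      inj₁ (inj₂ (y , not (sign y) , ∈-map⁺ proj₂ p∈ , proj₁ (reduced-ends p∈)))
    junction-colour {x ∷ xs , y} p∈ h (there z∈) with ∈-++⁻ (map (left χ) xs) z∈
    ... | inj₁ inner     = inj₂ (inner⊆xInnerColours p∈ inner)
    ... | inj₂ (here refl) =
      inj₁ (inj₂ (y , sign y , ∈-map⁺ proj₂ p∈ , trans (proj₂ (reduced-ends p∈)) (sym (proj₂ (chain-ends (x ∷ xs) h)))))

    realised-split : ∀ {z} → Realised χ t G z → Realised χᴿ t (map proj₂ P) z ⊎ z ∈ xInnerColours
    realised-split (inj₁ z≡t) = inj₁ (inj₁ z≡t)
    realised-split (inj₂ (x , e , x∈ , refl))
      with p , p∈ , x∈p ← find (∈-concatMap⁻ body {xs = P} (subst (x ∈_) (sym covers) x∈))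
      with c , d , h ← block-chain p∈
      = junction-colour p∈ h (chain-colour (body p) e h x∈p)

    length-xInnerColours : length xInnerColours + length xInnerColours + length P ≡ length G
    length-xInnerColours = begin
      length xInnerColours + length xInnerColours + length P
        ≡⟨ cong (_+ length P) (cong₂ _+_ length-x (trans length-x (∑-copies≡∑-paralogs w same-weight))) ⟩
      ∑ P (λ p → 𝟙 (not (flag p)) * w p) + ∑ P (λ p → 𝟙 (flag p) * w p) + length P
        ≡⟨ cong (_+ length P) (trans (sym (∑-+ P _ _)) (∑-cong P λ {p} _ → 𝟙-split (flag p) (w p))) ⟩
      ∑ P w + length P
        ≡⟨ trans (cong (_+ ∑ P w) (∑-one P)) (+-comm (length P) (∑ P w)) ⟨
      ∑ P (λ _ → 1) + ∑ P w
        ≡⟨ ∑-+ P (λ _ → 1) w ⟨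
      ∑ P (λ p → suc (w p))
        ≡⟨ ∑-cong P (λ {p} _ → cong suc (length-map (left χ) (List⁺.tail (proj₁ p)))) ⟩
      ∑ P (length ∘ body)
        ≡⟨ length-concatMap body P ⟨
      length (concatMap body P)
        ≡⟨ cong length covers ⟩
      length G ∎
      where
      open ≡-Reasoning
      flag : Block → Bool
      flag p = proj₂ (marker (proj₂ p))
      w : Block → ℕ
      w p = length (innerColours χ (proj₁ p))
      length-x : length xInnerColours ≡ ∑ P (λ p → 𝟙 (not (flag p)) * w p)
      length-x = trans (length-concatMap xInner P) (∑-cong P λ {p} _ → length-if (flag p) (innerColours χ (proj₁ p)))
        where
        length-if : ∀ b (cs : List ℕ) → length (if b then [] else cs) ≡ 𝟙 (not b) * length cs
        length-if true  cs = refl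
        length-if false cs = sym (+-identityʳ (length cs))
      same-weight : ∀ {p q} → p ∈ P → q ∈ P → paired (marker (proj₂ p)) (marker (proj₂ q)) ≡ true → w p ≡ w q
      same-weight {p} {q} p∈ q∈ pq =
        sym (↭-length (paralogous-inner p∈ (paralogous p∈ q∈ (paired⇒barᴹ (marker (proj₂ p)) (marker (proj₂ q)) pq))))

colourable-reduced : ∀ {G P C n} → Reduction G P → NumCycles (map proj₂ P) C → Colourable G n →
  ∃ λ b → n ≤ suc C + b × b + b + length P ≡ length G
colourable-reduced {P = P} {C} {n} red cycles col = length xInnerColours , n≤ , length-xInnerColours
  where
  open Colourable col using (chain; colours; distinct; realised; enough) renaming (telomere to t)
  open Reduced red
  open Chained chain
  open ChainedGenome (map proj₂ P) (Reduction.totdup red) reduced-chain using (realised-colours)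
  n≤ : n ≤ suc C + length xInnerColours
  n≤ with M , |M| , M∋ ← realised-colours cycles =
    ≤-trans enough (subst (length colours ≤_) length-M (unique-⊆⇒length≤ distinct colours⊆))
    where
    colours⊆ : colours ⊆ (t ∷ M) ++ xInnerColours
    colours⊆ z∈ with realised-split (realised z∈)
    ... | inj₁ in-R     = ∈-++⁺ˡ (M∋ in-R)
    ... | inj₂ in-inner = ∈-++⁺ʳ (t ∷ M) in-inner
    length-M : length ((t ∷ M) ++ xInnerColours) ≡ suc C + length xInnerColours
    length-M = trans (length-++ (t ∷ M)) (cong (λ m → suc m + length xInnerColours) |M|)

BISteps-length : ∀ {k G H} → BISteps k G H → length G ≡ length H
BISteps-length done                           = refl
BISteps-length (step (bi A X B Y D _ _) steps) =
  trans (↭-length (↭-sym (interchange-↭ A X B Y D))) (BISteps-length steps)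

halving-bound : ∀ ℓ k C b r → ℓ ∸ (k + k) ≤ suc C + b → b + b + r ≡ ℓ + ℓ → (r / 2 ∸ C) / 2 ≤ k
halving-bound ℓ k C b r ℓ-bound r≡ = s≤s⁻¹ (m<n*o⇒m/o<n (s≤s (≤-trans half∸C≤ (≤-reflexive (cong suc k+k≡)))))
  where
  X = C + suc (k + k)
  ℓ≤ : ℓ ≤ k + k + (suc C + b)
  ℓ≤ = ≤-trans (m≤n+m∸n ℓ (k + k)) (+-monoʳ-≤ (k + k) ℓ-bound)
  r≤ : r ≤ X * 2
  r≤ = +-cancelʳ-≤ (b + b) r (X * 2) (begin
    r + (b + b)                                       ≡⟨ +-comm r (b + b) ⟩
    b + b + r                                         ≡⟨ r≡ ⟩
    ℓ + ℓ                                             ≤⟨ +-mono-≤ ℓ≤ ℓ≤ ⟩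
    k + k + (suc C + b) + (k + k + (suc C + b))       ≡⟨ solve 3 (λ k C b → k :+ k :+ (con 1 :+ C :+ b) :+ (k :+ k :+ (con 1 :+ C :+ b))
                                                                := (C :+ (con 1 :+ (k :+ k))) :* con 2 :+ (b :+ b)) refl k C b ⟩
    X * 2 + (b + b)                                   ∎)
    where open ≤-Reasoning
  half∸C≤ : r / 2 ∸ C ≤ suc (k + k)
  half∸C≤ = m≤n+o⇒m∸n≤o (r / 2) C (s≤s⁻¹ (m<n*o⇒m/o<n (s≤s (≤-trans r≤ (n≤1+n _)))))
  k+k≡ : k + k ≡ k * 2
  k+k≡ = sym (trans (*-comm k 2) (cong (k +_) (+-identityʳ k)))

theorem5 : ∀ (G R : Genome) (C : ℕ) →
    TotDup G → SameSign G → Reduces G R → NumCycles R C →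
    ∀ (k : ℕ) (H : Genome) → BISteps k G H → OneTandem H →
    (nMarkers R ∸ C) / 2 ≤ k
theorem5 G R C _ _ (P , red , refl) cycles k H steps tandem
  with ℓ , |H|≡ℓ+ℓ , H-colourable ← colourable-tandem tandem
  with b , n≤ , |G|≡ ← colourable-reduced red cycles (colourable-BISteps steps H-colourable)
  = halving-bound ℓ k C b (length (map proj₂ P)) n≤
      (trans (cong (b + b +_) (length-map proj₂ P)) (trans |G|≡ (trans (BISteps-length steps) |H|≡ℓ+ℓ)))
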